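{- Let $G$ be a finite directed graph (multiple edges and loops allowed) with vertex set $V$ and edge set $E$, let $M$ be its signed incidence matrix, and let $\mathcal{M}=\mathcal{M}(G)$ be the graphical matroid represented by $M$. Let $H$ be a cut subgraph of $G$ and $\mathcal{N}$ the sub-matroid with base set $E(H)$. If the orientation of $H$ induced by $G$ is coherent acyclic (in the graph sense), then the orientation of $\mathcal{N}$ induced from $M$ is coherent acyclic (in the matroid sense).
   Context: The signed incidence matrix $M$ has rows indexed by $V$ and columns by $E$, with $M_{ve}=-1$ if $e$ points away from $v$, $+1$ if $e$ points towards $v$, and $0$ if $e$ is a loop or not incident to $v$. A subgraph is a subset of edges on the full vertex set. $H$ is a cut subgraph if there is an ordered partition $V=V_1\sqcup\dots\sqcup V_s$ such that $E(H)$ is exactly the set of edges of $G$ joining vertices in different parts; the orientation of $H$ is coherent acyclic (graph sense) if there is such a partition in which every edge $(u,v)$ of $H$ has $u\in V_i$, $v\in V_j$ with $i<j$. Let $\Gamma(\mathcal{M})=\operatorname{Row}(M)\cap\mathbb{Z}^E$. The orientation of $\mathcal{N}$ induced from $M$ is coherent acyclic (matroid sense) if for every $e\in E(H)$ there exists $z_e\in(\mathbb{Z}_{\ge0})^E$ supported on $E(H)$ with $e+z_e\in\Gamma(\mathcal{M})$, where $e$ also denotes the standard basis vector of $\mathbb{R}^E$. -}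

module Defs where

open import Data.Nat using (ℕ; zero; suc)
open import Data.Fin using (Fin; zero; suc; _<_)
open import Data.Fin.Subset using (Subset; _∈_; _∉_)
open import Data.Integer using (ℤ; +_; -[1+_]; _+_)
open import Data.Rational using (ℚ; 0ℚ; _/_) renaming (_+_ to _+ℚ_; _*_ to _*ℚ_)
open import Data.Product using (Σ; ∃; _×_)
open import Relation.Binary.PropositionalEquality using (_≡_; _≢_)
open import Relation.Nullary using (Dec; yes; no)
open import Function.Bundles using (_⇔_)
open import Function.Definitions using (Surjective)

record Digraph (n m : ℕ) : Set where
  field
    src : Fin m → Fin n
    tgt : Fin m → Fin n
open Digraph public

incidence : ∀ {n m} → Digraph n m → Fin n → Fin m → ℤ
incidence G v e with Data.Fin._≟_ (src G e) (tgt G e)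
... | yes _ = + 0
... | no _ with Data.Fin._≟_ v (src G e) | Data.Fin._≟_ v (tgt G e)
...   | yes _ | _     = -[1+ 0 ]
...   | no _  | yes _ = + 1
...   | no _  | no _  = + 0

toℚ : ℤ → ℚ
toℚ z = z / 1

Σℚ : ∀ {n} → (Fin n → ℚ) → ℚ
Σℚ {zero} f = 0ℚ
Σℚ {suc n} f = f zero +ℚ Σℚ (λ i → f (suc i))

-- Γ(M(G)) = Row(M) ∩ ℤ^E : integer vectors that are linear combinations of the
-- rows of M (coefficients taken in ℚ; since M is integral, this agrees with
-- real coefficients for integer target vectors).
InΓ : ∀ {n m} → Digraph n m → (Fin m → ℤ) → Set
InΓ {n} {m} G w =
  Σ (Fin n → ℚ) λ c → ∀ (f : Fin m) →
    Σℚ (λ v → c v *ℚ toℚ (incidence G v f)) ≡ toℚ (w f)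

-- An ordered partition V = V₁ ⊔ … ⊔ Vₛ, given by the index of the part of each
-- vertex (surjective, so that every part is nonempty).
record OrderedPartition (n : ℕ) : Set where
  field
    parts : ℕ
    part  : Fin n → Fin parts
    part-surj : Surjective _≡_ _≡_ part
open OrderedPartition public

IsCutOf : ∀ {n m} → Digraph n m → Subset m → OrderedPartition n → Set
IsCutOf {n} {m} G H P =
  ∀ (e : Fin m) → (e ∈ H) ⇔ (part P (src G e) ≢ part P (tgt G e))

IsCutSubgraph : ∀ {n m} → Digraph n m → Subset m → Set
IsCutSubgraph {n} G H = Σ (OrderedPartition n) λ P → IsCutOf G H P

CoherentAcyclicGraph : ∀ {n m} → Digraph n m → Subset m → Set
CoherentAcyclicGraph {n} {m} G H =
  Σ (OrderedPartition n) λ P → IsCutOf G H P ×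
    (∀ (e : Fin m) → e ∈ H → part P (src G e) < part P (tgt G e))

basisPlus : ∀ {m} → Fin m → (Fin m → ℕ) → Fin m → ℤ
basisPlus e z f with Data.Fin._≟_ e f
... | yes _ = + 1 + + z f
... | no _  = + z f

CoherentAcyclicMatroid : ∀ {n m} → Digraph n m → Subset m → Set
CoherentAcyclicMatroid {n} {m} G H =
  ∀ (e : Fin m) → e ∈ H →
    Σ (Fin m → ℕ) λ z → (∀ (f : Fin m) → f ∉ H → z f ≡ 0) × InΓ G (basisPlus e z)

-- The rank of the part containing a vertex is an integer potential on V; its
-- coboundary, the vector of rank differences along the edges, lies in the row
-- space of M (the potential supplies the coefficients of the rows). Because
-- the partition realises the cut, the coboundary vanishes off E(H), and
-- because the orientation is coherent it is at least 1 on E(H). Subtracting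
-- the basis vector e from it therefore leaves a nonnegative vector z supported
-- on E(H) with e + z in Γ(M).
module Submission where

open import Defs
open import Data.Nat using (ℕ)
open import Data.Fin.Subset using (Subset)

open import Algebra.Bundles using (Monoid)
import Algebra.Properties.Monoid.Sum as MonoidSum
import Algebra.Properties.CommutativeMonoid.Sum as CommutativeMonoidSum
open import Data.Nat as ℕ using (zero; suc; pred; _∸_)
import Data.Nat.Properties as ℕP
open import Data.Nat.Coprimality as Coprimality using (Coprime; 1-coprimeTo)
open import Data.Fin as Fin using (Fin; toℕ; _≟_)
open import Data.Fin.Properties using (suc-injective)
open import Data.Fin.Subset using (_∈_; _∉_)
open import Data.Fin.Subset.Properties using (_∈?_)
open import Data.Integer as ℤ using (ℤ; +_; 0ℤ; 1ℤ; _+_; _-_; _*_; -_)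
import Data.Integer.Properties as ℤP
open import Data.Rational as ℚ using (ℚ; mkℚ)
open import Data.Rational.Properties using (normalize-coprime)
open import Data.Product using (_,_)
open import Function.Base using (_∘_)
open import Function.Bundles using (Equivalence)
open import Relation.Nullary using (yes; no; contradiction)
open import Relation.Nullary.Decidable using (decidable-stable)
open import Relation.Binary.PropositionalEquality
  using (_≡_; _≢_; refl; sym; trans; cong; cong₂; module ≡-Reasoning)

module _ {c ℓ} (M : Monoid c ℓ) where
  open Monoid M
  open MonoidSum M using (sum; sum-cong-≋; sum-replicate-zero)
  open import Relation.Binary.Reasoning.Setoid setoid

  sum-supportedAt : ∀ {n} (a : Fin n) (g : Fin n → Carrier) →
    (∀ v → v ≢ a → g v ≈ ε) → sum g ≈ g a
  sum-supportedAt {suc n} Fin.zero g vanish = begin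
    g Fin.zero ∙ sum (g ∘ Fin.suc) ≈⟨ ∙-congˡ (sum-cong-≋ (λ v → vanish (Fin.suc v) λ ())) ⟩
    g Fin.zero ∙ sum {n} (λ _ → ε) ≈⟨ ∙-congˡ (sum-replicate-zero n) ⟩
    g Fin.zero ∙ ε                 ≈⟨ identityʳ _ ⟩
    g Fin.zero                     ∎
  sum-supportedAt {suc n} (Fin.suc a) g vanish = begin
    g Fin.zero ∙ sum (g ∘ Fin.suc) ≈⟨ ∙-congʳ (vanish Fin.zero λ ()) ⟩
    ε ∙ sum (g ∘ Fin.suc)          ≈⟨ identityˡ _ ⟩
    sum (g ∘ Fin.suc)              ≈⟨ sum-supportedAt a (g ∘ Fin.suc)
                                        (λ v v≢a → vanish (Fin.suc v) (v≢a ∘ suc-injective)) ⟩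
    g (Fin.suc a)                  ∎

open CommutativeMonoidSum ℤP.+-0-commutativeMonoid using (sum; sum-cong-≗; ∑-distrib-+)

δ : ∀ {n} → Fin n → Fin n → ℤ
δ a v with v ≟ a
... | yes _ = 1ℤ
... | no _  = 0ℤ

δ-diag : ∀ {n} (a : Fin n) → δ a a ≡ 1ℤ
δ-diag a with a ≟ a
... | yes _   = refl
... | no a≢a  = contradiction refl a≢a

δ-off : ∀ {n} {a v : Fin n} → v ≢ a → δ a v ≡ 0ℤ
δ-off {a = a} {v} v≢a with v ≟ a
... | yes v≡a = contradiction v≡a v≢a
... | no _    = refl

incidence≡δ-δ : ∀ {n m} (G : Digraph n m) v f →
  incidence G v f ≡ δ (tgt G f) v - δ (src G f) v
incidence≡δ-δ G v f with src G f ≟ tgt G f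
... | yes s≡t rewrite s≡t = sym (ℤP.+-inverseʳ (δ (tgt G f) v))
... | no s≢t with v ≟ src G f | v ≟ tgt G f
...   | yes v≡s | yes v≡t = contradiction (trans (sym v≡s) v≡t) s≢t
...   | yes _   | no _    = refl
...   | no _    | yes _   = refl
...   | no _    | no _    = refl

sum-*-δ : ∀ {n} (x : Fin n → ℤ) a → sum (λ v → x v * δ a v) ≡ x a
sum-*-δ x a = trans
  (sum-supportedAt ℤP.+-0-monoid a _ (λ v v≢a → trans (cong (x v *_) (δ-off v≢a)) (ℤP.*-zeroʳ (x v))))
  (trans (cong (x a *_) (δ-diag a)) (ℤP.*-identityʳ (x a)))

*-distribˡ-minus : ∀ x a b → x * (a - b) ≡ x * a + - x * b
*-distribˡ-minus x a b = trans (ℤP.*-distribˡ-+ x a (- b))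
  (cong (_+_ (x * a)) (trans (sym (ℤP.neg-distribʳ-* x b)) (ℤP.neg-distribˡ-* x b)))

incidence-column : ∀ {n m} (G : Digraph n m) (h : Fin n → ℤ) f →
  sum (λ v → h v * incidence G v f) ≡ h (tgt G f) - h (src G f)
incidence-column {n} G h f = begin
  sum (λ v → h v * incidence G v f)
    ≡⟨ sum-cong-≗ (λ v → trans (cong (h v *_) (incidence≡δ-δ G v f)) (*-distribˡ-minus (h v) _ _)) ⟩
  sum {n} (λ v → h v * δ t v + - h v * δ s v)
    ≡⟨ ∑-distrib-+ {n} (λ v → h v * δ t v) (λ v → - h v * δ s v) ⟩
  sum {n} (λ v → h v * δ t v) + sum {n} (λ v → - h v * δ s v)
    ≡⟨ cong₂ _+_ (sum-*-δ h t) (sum-*-δ (-_ ∘ h) s) ⟩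
  h t - h s ∎
  where
  open ≡-Reasoning
  s = src G f
  t = tgt G f

coprimeTo-1 : ∀ n → Coprime n 1
coprimeTo-1 n = Coprimality.sym (1-coprimeTo n)

-- With denominator 1 in normal form, ℚ's _+_ and _*_ compute ℤ's on numerators.
toℚ≡mkℚ : ∀ z → toℚ z ≡ mkℚ z 0 (coprimeTo-1 ℤ.∣ z ∣)
toℚ≡mkℚ (+ n)      = normalize-coprime (coprimeTo-1 n)
toℚ≡mkℚ ℤ.-[1+ n ] = cong ℚ.-_ (normalize-coprime (coprimeTo-1 (suc n)))

toℚ-homo-+ : ∀ a b → toℚ (a + b) ≡ toℚ a ℚ.+ toℚ b
toℚ-homo-+ a b rewrite toℚ≡mkℚ a | toℚ≡mkℚ b =
  cong₂ (λ x y → toℚ (x + y)) (sym (ℤP.*-identityʳ a)) (sym (ℤP.*-identityʳ b))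

toℚ-homo-* : ∀ a b → toℚ (a * b) ≡ toℚ a ℚ.* toℚ b
toℚ-homo-* a b rewrite toℚ≡mkℚ a | toℚ≡mkℚ b = refl

Σℚ-toℚ : ∀ {n} {q : Fin n → ℚ} (g : Fin n → ℤ) → (∀ v → q v ≡ toℚ (g v)) →
  Σℚ q ≡ toℚ (sum g)
Σℚ-toℚ {zero}  g q≡g = refl
Σℚ-toℚ {suc n} g q≡g =
  trans (cong₂ ℚ._+_ (q≡g Fin.zero) (Σℚ-toℚ (g ∘ Fin.suc) (q≡g ∘ Fin.suc)))
        (sym (toℚ-homo-+ (g Fin.zero) (sum (g ∘ Fin.suc))))

InΓ-cong : ∀ {n m} (G : Digraph n m) {w w′ : Fin m → ℤ} →
  (∀ f → w f ≡ w′ f) → InΓ G w → InΓ G w′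
InΓ-cong G w≡w′ (c , combination) = c , λ f → trans (combination f) (cong toℚ (w≡w′ f))

coboundary-InΓ : ∀ {n m} (G : Digraph n m) (h : Fin n → ℤ) →
  InΓ G (λ f → h (tgt G f) - h (src G f))
coboundary-InΓ G h = toℚ ∘ h , λ f →
  trans (Σℚ-toℚ _ (λ v → sym (toℚ-homo-* (h v) (incidence G v f))))
        (cong toℚ (incidence-column G h f))

decrementAt : ∀ {m} → Fin m → (Fin m → ℕ) → Fin m → ℕ
decrementAt e d f with e ≟ f
... | yes _ = pred (d f)
... | no _  = d f

decrementAt-zero : ∀ {m} (e : Fin m) (d : Fin m → ℕ) {f} → d f ≡ 0 → decrementAt e d f ≡ 0
decrementAt-zero e d {f} df≡0 with e ≟ f
... | yes _ = cong pred df≡0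
... | no _  = df≡0

decrementAt-self : ∀ {m} (e : Fin m) (d : Fin m → ℕ) → decrementAt e d e ≡ pred (d e)
decrementAt-self e d with e ≟ e
... | yes _   = refl
... | no e≢e = contradiction refl e≢e

decrementAt-other : ∀ {m} (e : Fin m) (d : Fin m → ℕ) {f} → e ≢ f → decrementAt e d f ≡ d f
decrementAt-other e d {f} e≢f with e ≟ f
... | yes e≡f = contradiction e≡f e≢f
... | no _    = refl

basisPlus-decrementAt : ∀ {m} (e : Fin m) (d : Fin m → ℕ) → 0 ℕ.< d e →
  ∀ f → basisPlus e (decrementAt e d) f ≡ + d f
basisPlus-decrementAt e d 0<de f with e ≟ f
... | yes refl = cong +_ (trans (cong suc (decrementAt-self e d)) (ℕP.suc-pred (d e) {{ℕ.>-nonZero 0<de}}))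
... | no e≢f   = cong +_ (decrementAt-other e d e≢f)

module Rank {n m} (G : Digraph n m) (H : Subset m) (P : OrderedPartition n)
            (cut : IsCutOf G H P) where

  rank : Fin n → ℕ
  rank v = toℕ (part P v)

  rankGap : Fin m → ℕ
  rankGap f = rank (tgt G f) ∸ rank (src G f)

  part-src≡tgt-off-cut : ∀ {f} → f ∉ H → part P (src G f) ≡ part P (tgt G f)
  part-src≡tgt-off-cut {f} f∉H =
    decidable-stable (part P (src G f) ≟ part P (tgt G f)) (f∉H ∘ Equivalence.from (cut f))

  rankGap-off-cut : ∀ {f} → f ∉ H → rankGap f ≡ 0
  rankGap-off-cut {f} f∉H =
    trans (cong (λ i → rank (tgt G f) ∸ toℕ i) (part-src≡tgt-off-cut f∉H)) (ℕP.n∸n≡0 (rank (tgt G f)))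

  module Coherent (forward : ∀ f → f ∈ H → part P (src G f) Fin.< part P (tgt G f)) where

    rank-monotone : ∀ f → rank (src G f) ℕ.≤ rank (tgt G f)
    rank-monotone f with f ∈? H
    ... | yes f∈H = ℕP.<⇒≤ (forward f f∈H)
    ... | no f∉H  = ℕP.≤-reflexive (cong toℕ (part-src≡tgt-off-cut f∉H))

    rankGap-on-cut : ∀ {f} → f ∈ H → 0 ℕ.< rankGap f
    rankGap-on-cut {f} f∈H = ℕP.m<n⇒0<n∸m (forward f f∈H)

    rank-coboundary : ∀ f → + rank (tgt G f) - + rank (src G f) ≡ + rankGap f
    rank-coboundary f =
      trans (ℤP.m-n≡m⊖n (rank (tgt G f)) (rank (src G f))) (ℤP.≤-⊖ (rank-monotone f))

-- The cut hypothesis is subsumed by the second one, which carries its own partition.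
proposition5p4 : ∀ (n m : ℕ) (G : Digraph n m) (H : Subset m) →
    IsCutSubgraph G H → CoherentAcyclicGraph G H → CoherentAcyclicMatroid G H
proposition5p4 n m G H _ (P , cut , forward) e e∈H =
  z , (λ f f∉H → decrementAt-zero e rankGap (rankGap-off-cut f∉H)) ,
  InΓ-cong G e+z≡coboundary (coboundary-InΓ G (+_ ∘ rank))
  where
  open Rank G H P cut
  open Coherent forward

  z : Fin m → ℕ
  z = decrementAt e rankGap

  e+z≡coboundary : ∀ f → + rank (tgt G f) - + rank (src G f) ≡ basisPlus e z f
  e+z≡coboundary f =
    trans (rank-coboundary f) (sym (basisPlus-decrementAt e rankGap (rankGap-on-cut e∈H) f))
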